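{- Let $(X,\mathcal{B})$ be a ball space such that $\mathcal{B}$ is closed under finite intersections. If $(\mathcal{B},\supseteq)$ is a generalized tree, then $(X,\mathcal{B})$ is tree-like.
   Context: A ball space $(X,\mathcal{B})$ is a nonempty set $X$ with a nonempty collection $\mathcal{B}$ of nonempty subsets of $X$ ("closed under finite intersections" means the intersection of two members of $\mathcal{B}$, whenever nonempty, lies in $\mathcal{B}$ — read as in the paper: $\mathcal{B}$ is closed under finite intersections). $(\mathcal{B},\supseteq)$ is a generalized tree if for every $B\in\mathcal{B}$ the set $\{C\in\mathcal{B}: C\supseteq B\}$ is linearly ordered by inclusion. $(X,\mathcal{B})$ is tree-like if for all $B_1,B_2\in\mathcal{B}$, $B_1\cap B_2\neq\emptyset$ implies $B_1\subseteq B_2$ or $B_2\subseteq B_1$. -}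

module Defs where

open import Level using (Level; _⊔_; suc)
open import Data.Product using (Σ; _×_; ∃)
open import Data.Sum using (_⊎_)

-- A ball space on a carrier X: a nonempty family of nonempty subsets of X,
-- presented as an index type I together with ball : I → (X → Set ℓ).

_⊆_ : ∀ {a ℓ} {X : Set a} → (X → Set ℓ) → (X → Set ℓ) → Set (a ⊔ ℓ)
A ⊆ B = ∀ x → A x → B x

record BallSpace {a} (X : Set a) (i ℓ : Level) : Set (a ⊔ suc i ⊔ suc ℓ) where
  field
    Idx       : Set i
    ball      : Idx → X → Set ℓ
    X-nonempty   : X
    Idx-nonempty : Idx
    ball-nonempty : ∀ k → ∃ λ x → ball k x

module _ {a i ℓ} {X : Set a} (S : BallSpace X i ℓ) where
  open BallSpace S

  -- closed under finite intersections: the intersection of two balls,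
  -- whenever nonempty, is again a ball (extensionally)
  ClosedUnderIntersections : Set (a ⊔ i ⊔ ℓ)
  ClosedUnderIntersections =
    ∀ b₁ b₂ → (∃ λ x → ball b₁ x × ball b₂ x) →
      Σ Idx λ c → ∀ x → (ball c x → ball b₁ x × ball b₂ x)
                        × (ball b₁ x × ball b₂ x → ball c x)

  GeneralizedTree : Set (a ⊔ i ⊔ ℓ)
  GeneralizedTree =
    ∀ b c₁ c₂ → ball b ⊆ ball c₁ → ball b ⊆ ball c₂ →
      (ball c₁ ⊆ ball c₂) ⊎ (ball c₂ ⊆ ball c₁)

  TreeLike : Set (a ⊔ i ⊔ ℓ)
  TreeLike =
    ∀ b₁ b₂ → (∃ λ x → ball b₁ x × ball b₂ x) →
      (ball b₁ ⊆ ball b₂) ⊎ (ball b₂ ⊆ ball b₁)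

module Submission where

open import Level using (Level)
open import Defs
open import Data.Product using (_×_; _,_; proj₁; proj₂)

lemma2p1 : ∀ {a i ℓ : Level} {X : Set a} (S : BallSpace X i ℓ) →
    ClosedUnderIntersections S → GeneralizedTree S → TreeLike S
lemma2p1 S closed tree b₁ b₂ meet =
  tree b₁∩b₂ b₁ b₂ (λ x p → proj₁ (∩-⊆ x p)) (λ x p → proj₂ (∩-⊆ x p))
  where
    open BallSpace S

    b₁∩b₂ : Idx
    b₁∩b₂ = proj₁ (closed b₁ b₂ meet)

    ∩-⊆ : ∀ x → ball b₁∩b₂ x → ball b₁ x × ball b₂ x
    ∩-⊆ x = proj₁ (proj₂ (closed b₁ b₂ meet) x)
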